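{- $\mathtt{incl}\text{ - }\mathtt{ESO}\text{ - }\mathtt{HORN}\subseteq\mathtt{Trellis}$: every language defined by an inclusion Horn formula is accepted by a trellis automaton (equivalently, by a real-time one-way cellular automaton).
   Context: Word structures: for a finite alphabet $\Sigma$ and a nonempty word $w=w_1\dots w_n\in\Sigma^n$, let $\langle w\rangle=([1,n];(Q_s)_{s\in\Sigma},\mathtt{min},\mathtt{max},\mathtt{suc},\mathtt{pred})$ with $Q_s(i)\iff w_i=s$, $\mathtt{min}(i)\iff i=1$, $\mathtt{max}(i)\iff i=n$, $\mathtt{suc}(i)=i+1$ for $i<n$, $\mathtt{suc}(n)=n$, $\mathtt{pred}(i)=i-1$ for $i>1$, $\mathtt{pred}(1)=1$. For $a\in\mathbb{Z}$, $x+a$ denotes $\mathtt{suc}^a(x)$ if $a\ge0$ and $\mathtt{pred}^{ -a}(x)$ if $a<0$; $x-b$ denotes $x+(-b)$. A formula $\Phi$ defines $\{w\in\Sigma^+:\langle w\rangle\models\Phi\}$. Inclusion Horn formulas ($\mathtt{incl}\text{ - }\mathtt{ESO}\text{ - }\mathtt{HORN}$): $\Phi=\exists\mathbf{R}\,\forall x\forall y\,\psi(x,y)$ with $\mathbf{R}$ a finite set of binary predicate symbols and $\psi$ a finite conjunction of Horn clauses $x\le y\wedge\delta_1\wedge\dots\wedge\delta_r\to\delta_0$, where $\delta_0$ is $R(x,y)$ ($R\in\mathbf{R}$) or $\bot$, and each $\delta_i$ ($i\ge1$) is one of: $U(x+a)$, $\neg U(x+a)$, $U(y+a)$, $\neg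 U(y+a)$ ($U\in\{(Q_s)_{s\in\Sigma},\mathtt{min},\mathtt{max}\}$, $a\in\mathbb{Z}$); $x=y$ or $x<y$; $S(x+a,y-b)\wedge x+a\le y-b$ ($S\in\mathbf{R}$, $a,b\ge0$). Trellis automata: $(Q,\Sigma,Q_{accept},\delta)$ with finite $Q\supseteq\Sigma$, $Q_{accept}\subseteq Q$, $\delta:Q^2\to Q$; it assigns to each subword $w_x\dots w_y$ of the input a state: $w_x$ if $x=y$, and $\delta(q_l,q_r)$ if $x<y$, where $q_l,q_r$ are the states assigned to $w_x\dots w_{y-1}$ and $w_{x+1}\dots w_y$; $w$ is accepted iff the state assigned to $w$ is in $Q_{accept}$. $\mathtt{Trellis}$ is the class of languages accepted by trellis automata; equivalently by one-way cellular automata (neighborhood $\{ -1,0\}$, parallel input, output on the last cell) in real time $n$. -}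

module Defs where

open import Data.Nat using (ℕ; zero; suc)
open import Data.Integer using (ℤ; +_; -[1+_])
open import Data.Fin using (Fin; zero; suc; toℕ; fromℕ; pred) renaming (_≤_ to _≤F_; _<_ to _<F_)
open import Data.Vec using (Vec; _∷_; []; lookup; init; tail)
open import Data.Bool using (Bool; true)
open import Data.List using (List)
open import Data.List.Relation.Unary.All using (All)
open import Data.Sum using (_⊎_; inj₁; inj₂)
open import Data.Product using (Σ; _×_)
open import Data.Empty using (⊥)
open import Relation.Nullary using (¬_)
open import Relation.Binary.PropositionalEquality using (_≡_)

-- A nonempty word of length (suc n) is a  Vec (Fin k) (suc n);
-- positions 1..n+1 of the paper are the 0-based  Fin (suc n).

Lang : ℕ → Set₁
Lang k = (n : ℕ) → Vec (Fin k) (suc n) → Set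

-- Trellis automata.  The state set is Q = Σ ⊎ Fin m  (so Q ⊇ Σ, Q finite).

record Trellis (k : ℕ) : Set where
  field
    m      : ℕ
    δ      : Fin k ⊎ Fin m → Fin k ⊎ Fin m → Fin k ⊎ Fin m
    accept : Fin k ⊎ Fin m → Bool

trellisState : ∀ {k} (T : Trellis k) {n : ℕ} → Vec (Fin k) (suc n) → Fin k ⊎ Fin (Trellis.m T)
trellisState T {zero}  (a ∷ []) = inj₁ a
trellisState T {suc n} w        = Trellis.δ T (trellisState T (init w)) (trellisState T (tail w))

Accepts : ∀ {k} → Trellis k → Lang k
Accepts T n w = Trellis.accept T (trellisState T w) ≡ true

InTrellis : ∀ {k} → Lang k → Set
InTrellis {k} L = Σ (Trellis k) λ T →
  (n : ℕ) (w : Vec (Fin k) (suc n)) → (L n w → Accepts T n w) × (Accepts T n w → L n w)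

clamp : (n : ℕ) → ℕ → Fin (suc n)
clamp zero    _       = zero
clamp (suc n) zero    = zero
clamp (suc n) (suc i) = suc (clamp n i)

sucP : ∀ {n} → Fin (suc n) → Fin (suc n)   -- suc(i) = i+1, suc(max) = max
sucP {n} i = clamp n (suc (toℕ i))

predP : ∀ {n} → Fin (suc n) → Fin (suc n)  -- pred(i) = i-1, pred(min) = min
predP = pred

iter : ∀ {A : Set} → (A → A) → ℕ → A → A
iter f zero    x = x
iter f (suc a) x = f (iter f a x)

_⊕_ : ∀ {n} → Fin (suc n) → ℤ → Fin (suc n)
x ⊕ (+ a)     = iter sucP a x
x ⊕ -[1+ a ]  = iter predP (suc a) x

_⊖_ : ∀ {n} → Fin (suc n) → ℕ → Fin (suc n)
x ⊖ b = iter predP b x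

data Atom (k : ℕ) : Set where
  Q    : Fin k → Atom k
  minA : Atom k
  maxA : Atom k

data Var : Set where
  vx vy : Var

data Literal (k r : ℕ) : Set where
  pos  : Atom k → Var → ℤ → Literal k r
  neg  : Atom k → Var → ℤ → Literal k r
  eqxy : Literal k r
  ltxy : Literal k r
  rel  : Fin r → ℕ → ℕ → Literal k r       -- S(x + a, y - b) ∧ x + a ≤ y - b

data Head (r : ℕ) : Set where
  relH : Fin r → Head r
  botH : Head r

record Clause (k r : ℕ) : Set where
  constructor _⇒_
  field
    body : List (Literal k r)
    head : Head r

-- Φ = ∃R ∀x∀y ψ with ψ a finite conjunction of Horn clauses
record InclHorn (k : ℕ) : Set where
  field
    r       : ℕ
    clauses : List (Clause k r)

Interp : ℕ → ℕ → Set
Interp r n = Fin r → Fin (suc n) → Fin (suc n) → Bool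

module _ {k r n : ℕ} (w : Vec (Fin k) (suc n)) (R : Interp r n) (x y : Fin (suc n)) where

  atomHolds : Atom k → Fin (suc n) → Set
  atomHolds (Q s) i = lookup w i ≡ s
  atomHolds minA  i = i ≡ zero
  atomHolds maxA  i = i ≡ fromℕ n

  varVal : Var → Fin (suc n)
  varVal vx = x
  varVal vy = y

  litHolds : Literal k r → Set
  litHolds (pos U v a) = atomHolds U (varVal v ⊕ a)
  litHolds (neg U v a) = ¬ atomHolds U (varVal v ⊕ a)
  litHolds eqxy        = x ≡ y
  litHolds ltxy        = x <F y
  litHolds (rel S a b) = (R S (x ⊕ (+ a)) (y ⊖ b) ≡ true) × (x ⊕ (+ a) ≤F y ⊖ b)

  headHolds : Head r → Set
  headHolds (relH S) = R S x y ≡ true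
  headHolds botH     = ⊥

  clauseHolds : Clause k r → Set
  clauseHolds (b ⇒ h) = x ≤F y → All litHolds b → headHolds h

Models : ∀ {k} → InclHorn k → Lang k
Models Φ n w = Σ (Interp (InclHorn.r Φ) n) λ R →
  (x y : Fin (suc n)) → All (clauseHolds w R x y) (InclHorn.clauses Φ)

-- Let c bound the offsets in the clauses of Φ.  Instantiated at (x , y), a clause
-- inspects only letters within distance c of x and of y, and pairs
-- (x + a , y - b) with a , b ≤ c, which lie strictly inside [x , y] unless they
-- are (x , y) itself.  So the least interpretation closed under the R-clauses,
-- and whether some ⊥-clause fires on it at a pair inside [x , y], can be computed
-- by recursion over the subwords of w, which is what a trellis automaton does.
-- The least interpretation is contained in every model, hence ⟨w⟩ ⊨ Φ iff no
-- ⊥-clause fires.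

module Submission where

open import Defs
open import Data.Nat using (ℕ; zero; suc; _+_; _*_; _^_; _∸_; _≤_; _<_; z≤n; s≤s; _⊓_; _≤ᵇ_; _≤?_)
open import Data.Nat.Properties
open import Data.Nat.ListAction using (sum)
open import Data.Integer using (ℤ; +_; -[1+_]; ∣_∣)
open import Data.Fin using (Fin; zero; suc; toℕ; inject₁; combine; remQuot) renaming (_≟_ to _≟F_)
open import Data.Fin.Properties using (toℕ-injective; toℕ-inject₁; toℕ-fromℕ; toℕ≤pred[n]; remQuot-combine)
open import Data.Vec using (Vec; _∷_; []; lookup; init; tail; tabulate; replicate; zipWith)
open import Data.Vec.Properties using (lookup∘tabulate; tabulate∘lookup; tabulate-cong; lookup-zipWith; lookup-replicate)
open import Data.Bool using (Bool; true; false; T; _∧_; _∨_; not; if_then_else_)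
open import Data.Bool.Properties using (∨-zeroʳ; ∨-identityʳ; ∧-conicalˡ; ∧-conicalʳ; not-involutive; T-≡)
open import Data.Product using (Σ; _×_; _,_; proj₁; proj₂; uncurry′)
import Data.Product as Product
open import Data.Sum using (_⊎_; inj₁; inj₂)
open import Data.Empty using (⊥; ⊥-elim)
open import Data.List using (List; []; _∷_; map)
open import Data.Bool.ListAction using (any)
open import Data.List.Relation.Unary.All as All using (All; []; _∷_)
open import Data.List.Relation.Unary.Any using (here; there)
open import Data.List.Relation.Unary.Any.Properties using (any⁺; any⁻)
open import Data.List.Membership.Propositional using (_∈_; find; lose)
open import Data.List.Membership.Propositional.Properties using (∈-map⁺)
open import Function using (_∘_; _⇔_; mk⇔; Equivalence)
import Function.Properties.Equivalence as ⇔
open import Relation.Nullary using (¬_; yes; no)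
open import Relation.Nullary.Decidable using (⌊_⌋)
open import Relation.Binary.PropositionalEquality
  using (_≡_; _≢_; refl; sym; trans; cong; cong₂; subst; subst₂; module ≡-Reasoning)

data Code : Set where
  bool : Code
  fin  : ℕ → Code
  _⊗_  : Code → Code → Code
  vec  : ℕ → Code → Code

infixr 5 _⊗_

⟦_⟧ : Code → Set
⟦ bool ⟧    = Bool
⟦ fin n ⟧   = Fin n
⟦ a ⊗ b ⟧   = ⟦ a ⟧ × ⟦ b ⟧
⟦ vec n a ⟧ = Vec ⟦ a ⟧ n

size : Code → ℕ
size bool      = 2
size (fin n)   = n
size (a ⊗ b)   = size a * size b
size (vec n a) = size a ^ n

encode : ∀ a → ⟦ a ⟧ → Fin (size a)
encode bool      false    = zero
encode bool      true     = suc zero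
encode (fin n)   i        = i
encode (a ⊗ b)   (u , v)  = combine (encode a u) (encode b v)
encode (vec zero a)    []       = zero
encode (vec (suc n) a) (v ∷ vs) = combine (encode a v) (encode (vec n a) vs)

decode : ∀ a → Fin (size a) → ⟦ a ⟧
decode bool      zero    = false
decode bool      (suc _) = true
decode (fin n)   i       = i
decode (a ⊗ b)   i       = Product.map (decode a) (decode b) (remQuot (size b) i)
decode (vec zero a)    _ = []
decode (vec (suc n) a) i =
  uncurry′ (λ v vs → decode a v ∷ decode (vec n a) vs) (remQuot (size (vec n a)) i)

decode-encode : ∀ a (v : ⟦ a ⟧) → decode a (encode a v) ≡ v
decode-encode bool false = refl
decode-encode bool true  = refl
decode-encode (fin n) i  = refl
decode-encode (a ⊗ b) (u , v) =
  trans (cong (Product.map (decode a) (decode b)) (remQuot-combine {size a} (encode a u) (encode b v)))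
        (cong₂ _,_ (decode-encode a u) (decode-encode b v))
decode-encode (vec zero a) [] = refl
decode-encode (vec (suc n) a) (v ∷ vs) =
  trans (cong (uncurry′ (λ v vs → decode a v ∷ decode (vec n a) vs))
              (remQuot-combine {size a} (encode a v) (encode (vec n a) vs)))
        (cong₂ _∷_ (decode-encode a v) (decode-encode (vec n a) vs))

_⟶_ : Code → Code → Code
bool ⟶ s          = s ⊗ s
fin n ⟶ s         = vec n s
(a ⊗ b) ⟶ s       = a ⟶ (b ⟶ s)
vec zero a ⟶ s    = s
vec (suc n) a ⟶ s = a ⟶ (vec n a ⟶ s)

infixr 4 _⟶_

lookupTable : ∀ a s → ⟦ a ⟶ s ⟧ → ⟦ a ⟧ → ⟦ s ⟧
lookupTable bool s (t , f) true  = t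
lookupTable bool s (t , f) false = f
lookupTable (fin n) s t i = lookup t i
lookupTable (a ⊗ b) s t (u , v) = lookupTable b s (lookupTable a (b ⟶ s) t u) v
lookupTable (vec zero a) s t [] = t
lookupTable (vec (suc n) a) s t (v ∷ vs) =
  lookupTable (vec n a) s (lookupTable a (vec n a ⟶ s) t v) vs

tabulateTable : ∀ a s → (⟦ a ⟧ → ⟦ s ⟧) → ⟦ a ⟶ s ⟧
tabulateTable bool s f = f true , f false
tabulateTable (fin n) s f = tabulate f
tabulateTable (a ⊗ b) s f = tabulateTable a (b ⟶ s) (λ u → tabulateTable b s (λ v → f (u , v)))
tabulateTable (vec zero a) s f = f []
tabulateTable (vec (suc n) a) s f =
  tabulateTable a (vec n a ⟶ s) (λ v → tabulateTable (vec n a) s (λ vs → f (v ∷ vs)))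

lookupTable∘tabulateTable : ∀ a s f (v : ⟦ a ⟧) → lookupTable a s (tabulateTable a s f) v ≡ f v
lookupTable∘tabulateTable bool s f true  = refl
lookupTable∘tabulateTable bool s f false = refl
lookupTable∘tabulateTable (fin n) s f i = lookup∘tabulate f i
lookupTable∘tabulateTable (a ⊗ b) s f (u , v)
  rewrite lookupTable∘tabulateTable a (b ⟶ s) (λ u → tabulateTable b s (λ v → f (u , v))) u
  = lookupTable∘tabulateTable b s _ v
lookupTable∘tabulateTable (vec zero a) s f [] = refl
lookupTable∘tabulateTable (vec (suc n) a) s f (v ∷ vs)
  rewrite lookupTable∘tabulateTable a (vec n a ⟶ s) (λ v → tabulateTable (vec n a) s (λ vs → f (v ∷ vs))) v
  = lookupTable∘tabulateTable (vec n a) s _ vs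

record Coded (A : Set) : Set where
  field
    code            : Code
    toCode          : A → ⟦ code ⟧
    fromCode        : ⟦ code ⟧ → A
    fromCode-toCode : ∀ x → fromCode (toCode x) ≡ x

∨-trueˡ : ∀ {a} b → a ≡ true → a ∨ b ≡ true
∨-trueˡ b refl = refl

∨-trueʳ : ∀ a {b} → b ≡ true → a ∨ b ≡ true
∨-trueʳ a refl = ∨-zeroʳ a

∨-true-split : ∀ a {b} → a ∨ b ≡ true → a ≡ true ⊎ b ≡ true
∨-true-split true  _ = inj₁ refl
∨-true-split false h = inj₂ h

∧-true : ∀ {a b} → a ≡ true → b ≡ true → a ∧ b ≡ true
∧-true refl refl = refl

false≢true : false ≢ true
false≢true ()

_⊆_ : ∀ {m} → Vec Bool m → Vec Bool m → Set
u ⊆ v = ∀ i → lookup u i ≡ true → lookup v i ≡ true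

⊆-or-witness : ∀ {m} (u v : Vec Bool m) → u ⊆ v ⊎ Σ (Fin m) λ i → lookup u i ≡ true × lookup v i ≡ false
⊆-or-witness [] [] = inj₁ (λ ())
⊆-or-witness (false ∷ u) (b ∷ v) with ⊆-or-witness u v
... | inj₁ u⊆v         = inj₁ λ { zero () ; (suc i) h → u⊆v i h }
... | inj₂ (i , p , q) = inj₂ (suc i , p , q)
⊆-or-witness (true ∷ u) (true ∷ v) with ⊆-or-witness u v
... | inj₁ u⊆v         = inj₁ λ { zero _ → refl ; (suc i) h → u⊆v i h }
... | inj₂ (i , p , q) = inj₂ (suc i , p , q)
⊆-or-witness (true ∷ u) (false ∷ v) = inj₂ (zero , refl , refl)

trues : ∀ {m} → Vec Bool m → ℕ
trues []           = 0
trues (true ∷ v)   = suc (trues v)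
trues (false ∷ v)  = trues v

trues≤length : ∀ {m} (v : Vec Bool m) → trues v ≤ m
trues≤length []          = z≤n
trues≤length (true ∷ v)  = s≤s (trues≤length v)
trues≤length (false ∷ v) = ≤-trans (trues≤length v) (n≤1+n _)

zipWith-∨-⊆ : ∀ {m} (u v : Vec Bool m) → u ⊆ v → zipWith _∨_ v u ≡ v
zipWith-∨-⊆ [] [] _ = refl
zipWith-∨-⊆ (false ∷ u) (b ∷ v) u⊆v = cong₂ _∷_ (∨-identityʳ b) (zipWith-∨-⊆ u v (λ i → u⊆v (suc i)))
zipWith-∨-⊆ (true ∷ u) (b ∷ v) u⊆v rewrite u⊆v zero refl = cong (true ∷_) (zipWith-∨-⊆ u v (λ i → u⊆v (suc i)))

trues-zipWith-∨ : ∀ {m} (v u : Vec Bool m) → trues v ≤ trues (zipWith _∨_ v u)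
trues-zipWith-∨ [] [] = z≤n
trues-zipWith-∨ (true ∷ v) (a ∷ u)      = s≤s (trues-zipWith-∨ v u)
trues-zipWith-∨ (false ∷ v) (true ∷ u)  = ≤-trans (trues-zipWith-∨ v u) (n≤1+n _)
trues-zipWith-∨ (false ∷ v) (false ∷ u) = trues-zipWith-∨ v u

trues-zipWith-∨-< : ∀ {m} (v u : Vec Bool m) i → lookup u i ≡ true → lookup v i ≡ false →
                    trues v < trues (zipWith _∨_ v u)
trues-zipWith-∨-< (false ∷ v) (true ∷ u) zero _ _ = s≤s (trues-zipWith-∨ v u)
trues-zipWith-∨-< (true ∷ v) (a ∷ u) (suc i) p q = s≤s (trues-zipWith-∨-< v u i p q)
trues-zipWith-∨-< (false ∷ v) (true ∷ u) (suc i) p q = ≤-trans (trues-zipWith-∨-< v u i p q) (n≤1+n _)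
trues-zipWith-∨-< (false ∷ v) (false ∷ u) (suc i) p q = trues-zipWith-∨-< v u i p q

-- Kleene iteration of an arbitrary (not necessarily monotone) operator, made
-- inflationary by accumulating: it stabilises within m + 1 rounds because the
-- number of true entries grows in every round that is not yet closed.
module Inflation {m : ℕ} (f : Vec Bool m → Vec Bool m) where

  inflate : ℕ → Vec Bool m
  inflate zero    = replicate m false
  inflate (suc t) = zipWith _∨_ (inflate t) (f (inflate t))

  Closed : Vec Bool m → Set
  Closed v = f v ⊆ v

  closed-or-growing : ∀ t → Closed (inflate t) ⊎ t ≤ trues (inflate t)
  closed-or-growing zero = inj₂ z≤n
  closed-or-growing (suc t) with closed-or-growing t | ⊆-or-witness (f (inflate t)) (inflate t)
  ... | inj₁ closed | _ = inj₁ (subst Closed (sym (zipWith-∨-⊆ _ _ closed)) closed)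
  ... | inj₂ _ | inj₁ closed = inj₁ (subst Closed (sym (zipWith-∨-⊆ _ _ closed)) closed)
  ... | inj₂ t≤ | inj₂ (i , p , q) = inj₂ (≤-trans (s≤s t≤) (trues-zipWith-∨-< (inflate t) (f (inflate t)) i p q))

  inflate-closed : Closed (inflate (suc m))
  inflate-closed with closed-or-growing (suc m)
  ... | inj₁ closed = closed
  ... | inj₂ m<    = ⊥-elim (<⇒≱ (s≤s ≤-refl) (≤-trans m< (trues≤length (inflate (suc m)))))

  inflate-least : ∀ (U : Fin m → Set) →
    (∀ v → (∀ i → lookup v i ≡ true → U i) → ∀ i → lookup (f v) i ≡ true → U i) →
    ∀ t i → lookup (inflate t) i ≡ true → U i
  inflate-least U f-preserves zero i h = ⊥-elim (false≢true (trans (sym (lookup-replicate i false)) h))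
  inflate-least U f-preserves (suc t) i h rewrite lookup-zipWith _∨_ i (inflate t) (f (inflate t))
    with ∨-true-split (lookup (inflate t) i) h
  ... | inj₁ p = inflate-least U f-preserves t i p
  ... | inj₂ p = f-preserves (inflate t) (inflate-least U f-preserves t) i p

≤ᵇ-true : ∀ {m n} → m ≤ n → (m ≤ᵇ n) ≡ true
≤ᵇ-true {m} {n} m≤n with m ≤ᵇ n | ≤⇒≤ᵇ {m} {n} m≤n
... | true | _ = refl

≤ᵇ-false : ∀ {m n} → ¬ m ≤ n → (m ≤ᵇ n) ≡ false
≤ᵇ-false {m} {n} m≰n with m ≤ᵇ n in eq
... | false = refl
... | true  = ⊥-elim (m≰n (≤ᵇ⇒≤ m n (subst T (sym eq) _)))

≤ᵇ-sound : ∀ {m n} → (m ≤ᵇ n) ≡ true → m ≤ n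
≤ᵇ-sound {m} {n} eq = ≤ᵇ⇒≤ m n (subst T (sym eq) _)

toℕ-clamp : ∀ n i → toℕ (clamp n i) ≡ i ⊓ n
toℕ-clamp zero    zero    = refl
toℕ-clamp zero    (suc i) = refl
toℕ-clamp (suc n) zero    = refl
toℕ-clamp (suc n) (suc i) = cong suc (toℕ-clamp n i)

toℕ-clamp-≤ : ∀ {n i} → i ≤ n → toℕ (clamp n i) ≡ i
toℕ-clamp-≤ {n} {i} i≤n = trans (toℕ-clamp n i) (m≤n⇒m⊓n≡m i≤n)

clamp-toℕ : ∀ {n} (x : Fin (suc n)) → clamp n (toℕ x) ≡ x
clamp-toℕ x = toℕ-injective (toℕ-clamp-≤ (toℕ≤pred[n] x))

suc-⊓ : ∀ m n → suc (m ⊓ n) ⊓ n ≡ suc m ⊓ n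
suc-⊓ m n with m ≤? n
... | yes m≤n rewrite m≤n⇒m⊓n≡m m≤n = refl
... | no m≰n  rewrite m≥n⇒m⊓n≡n (≰⇒≥ m≰n) =
  trans (m≥n⇒m⊓n≡n (n≤1+n n)) (sym (m≥n⇒m⊓n≡n (≤-trans (≰⇒≥ m≰n) (n≤1+n m))))

toℕ-iter-sucP : ∀ {n} (x : Fin (suc n)) p → toℕ (iter sucP p x) ≡ (toℕ x + p) ⊓ n
toℕ-iter-sucP {n} x zero = sym (trans (cong (_⊓ n) (+-identityʳ (toℕ x))) (m≤n⇒m⊓n≡m (toℕ≤pred[n] x)))
toℕ-iter-sucP {n} x (suc p) = begin
  toℕ (clamp n (suc (toℕ (iter sucP p x)))) ≡⟨ toℕ-clamp n _ ⟩
  suc (toℕ (iter sucP p x)) ⊓ n             ≡⟨ cong (λ j → suc j ⊓ n) (toℕ-iter-sucP x p) ⟩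
  suc ((toℕ x + p) ⊓ n) ⊓ n                 ≡⟨ suc-⊓ (toℕ x + p) n ⟩
  suc (toℕ x + p) ⊓ n                       ≡⟨ cong (_⊓ n) (+-suc (toℕ x) p) ⟨
  (toℕ x + suc p) ⊓ n                       ∎
  where open ≡-Reasoning

toℕ-predP : ∀ {n} (i : Fin (suc n)) → toℕ (predP i) ≡ toℕ i ∸ 1
toℕ-predP zero    = refl
toℕ-predP (suc i) = toℕ-inject₁ i

toℕ-iter-predP : ∀ {n} (x : Fin (suc n)) q → toℕ (iter predP q x) ≡ toℕ x ∸ q
toℕ-iter-predP x zero    = refl
toℕ-iter-predP x (suc q) = begin
  toℕ (predP (iter predP q x)) ≡⟨ toℕ-predP (iter predP q x) ⟩
  toℕ (iter predP q x) ∸ 1     ≡⟨ cong (_∸ 1) (toℕ-iter-predP x q) ⟩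
  toℕ x ∸ q ∸ 1                ≡⟨ ∸-+-assoc (toℕ x) q 1 ⟩
  toℕ x ∸ (q + 1)              ≡⟨ cong (toℕ x ∸_) (+-comm q 1) ⟩
  toℕ x ∸ suc q                ∎
  where open ≡-Reasoning

shift : ℕ → ℕ → ℤ → ℕ
shift n X (+ p)     = (X + p) ⊓ n
shift n X -[1+ q ]  = X ∸ suc q

toℕ-⊕ : ∀ {n} (x : Fin (suc n)) o → toℕ (x ⊕ o) ≡ shift n (toℕ x) o
toℕ-⊕ x (+ p)    = toℕ-iter-sucP x p
toℕ-⊕ x -[1+ q ] = toℕ-iter-predP x (suc q)

toℕ-⊖ : ∀ {n} (y : Fin (suc n)) b → toℕ (y ⊖ b) ≡ toℕ y ∸ b
toℕ-⊖ = toℕ-iter-predP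

init-tabulate : ∀ {A : Set} {n} (f : Fin (suc n) → A) → init (tabulate f) ≡ tabulate (f ∘ inject₁)
init-tabulate {n = zero}  f = refl
init-tabulate {n = suc n} f = cong (f zero ∷_) (init-tabulate (f ∘ suc))

module BoundedContext (k c : ℕ) where

  Cell : Set
  Cell = Bool × Fin k

  Context : Set
  Context = Vec Cell (suc c)

  contextCode : Code
  contextCode = vec (suc c) (bool ⊗ fin k)

  push : Cell → Context → Context
  push v xs = v ∷ init xs

  outside : Fin k → Context
  outside a = tabulate (λ _ → false , a)

  -- Cell i of the left (right) context of position X describes position X - 1 - i
  -- (X + 1 + i): whether it lies in the word, and its letter, where positions
  -- outside the word carry the letter of the nearest end of the word.
  module _ {n : ℕ} (w : Vec (Fin k) (suc n)) where

    letter : ℕ → Fin k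
    letter i = lookup w (clamp n i)

    leftCell : ℕ → Fin (suc c) → Cell
    leftCell X i = (suc (toℕ i) ≤ᵇ X) , letter (X ∸ suc (toℕ i))

    rightCell : ℕ → Fin (suc c) → Cell
    rightCell Y i = (Y + suc (toℕ i) ≤ᵇ n) , letter (Y + suc (toℕ i))

    leftContext : ℕ → Context
    leftContext X = tabulate (leftCell X)

    rightContext : ℕ → Context
    rightContext Y = tabulate (rightCell Y)

    letter-⊓ : ∀ m → letter (m ⊓ n) ≡ letter m
    letter-⊓ m = cong (lookup w) (toℕ-injective (begin
      toℕ (clamp n (m ⊓ n)) ≡⟨ toℕ-clamp n (m ⊓ n) ⟩
      m ⊓ n ⊓ n             ≡⟨ ⊓-assoc m n n ⟩
      m ⊓ (n ⊓ n)           ≡⟨ cong (m ⊓_) (⊓-idem n) ⟩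
      m ⊓ n                 ≡⟨ toℕ-clamp n m ⟨
      toℕ (clamp n m)       ∎))
      where open ≡-Reasoning

    subword : ℕ → (len : ℕ) → Vec (Fin k) (suc len)
    subword X len = tabulate (λ i → letter (X + toℕ i))

    push-leftContext : ∀ X → push (true , letter X) (leftContext X) ≡ leftContext (suc X)
    push-leftContext X = cong ((true , letter X) ∷_)
      (trans (init-tabulate (leftCell X))
             (tabulate-cong (λ i → cong (λ j → cellAt (suc j)) (toℕ-inject₁ i))))
      where
      cellAt : ℕ → Cell
      cellAt j = (j ≤ᵇ X) , letter (X ∸ j)

    push-rightContext : ∀ Y → suc Y ≤ n → push (true , letter (suc Y)) (rightContext (suc Y)) ≡ rightContext Y
    push-rightContext Y Y<n = cong₂ _∷_ (cong₂ _,_ (sym inside) (cong letter (sym (+-comm Y 1))))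
      (trans (init-tabulate (rightCell (suc Y)))
             (tabulate-cong (λ i → cong cellAt (trans (cong (λ j → suc Y + suc j) (toℕ-inject₁ i))
                                                       (sym (+-suc Y (suc (toℕ i))))))))
      where
      cellAt : ℕ → Cell
      cellAt p = (p ≤ᵇ n) , letter p
      inside : (Y + 1 ≤ᵇ n) ≡ true
      inside = ≤ᵇ-true (subst (_≤ n) (+-comm 1 Y) Y<n)

    tail-subword : ∀ X len → tail (subword X (suc len)) ≡ subword (suc X) len
    tail-subword X len = tabulate-cong (λ i → cong letter (+-suc X (toℕ i)))

    init-subword : ∀ X len → init (subword X (suc len)) ≡ subword X len
    init-subword X len = trans (init-tabulate (λ i → letter (X + toℕ i)))
                               (tabulate-cong (λ i → cong (λ j → letter (X + j)) (toℕ-inject₁ i)))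

    subword-whole : subword 0 n ≡ w
    subword-whole = trans (tabulate-cong (λ i → cong (lookup w) (clamp-toℕ i))) (tabulate∘lookup w)

    rightContext-end : rightContext n ≡ outside (letter n)
    rightContext-end = tabulate-cong (λ i → cong₂ _,_ (beyond i) (cong (lookup w) (clamped i)))
      where
      n<n+1+i : ∀ i → n < n + suc i
      n<n+1+i i = subst (n <_) (sym (+-suc n i)) (s≤s (m≤m+n n i))
      beyond : ∀ (i : Fin (suc c)) → (n + suc (toℕ i) ≤ᵇ n) ≡ false
      beyond i = ≤ᵇ-false (<⇒≱ (n<n+1+i (toℕ i)))
      clamped : ∀ (i : Fin (suc c)) → clamp n (n + suc (toℕ i)) ≡ clamp n n
      clamped i = toℕ-injective (trans (toℕ-clamp n _) (trans (m≥n⇒m⊓n≡n (m≤m+n n _)) (sym (toℕ-clamp-≤ ≤-refl))))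

-- A trellis automaton can evaluate any recursion over subwords whose base case
-- may also inspect a bounded context around the letter: its state on a subword
-- stores the first and last letters together with the table of results for all
-- possible outer contexts, and the two child tables are combined by pushing the
-- other child's outer letter onto the context.
module ContextTrellis {k c : ℕ} {St : Set} (coded : Coded St)
  (base : BoundedContext.Context k c → Fin k → BoundedContext.Context k c → St)
  (join : St → St → St) (accept : St → Bool) where

  open BoundedContext k c
  open Coded coded

  contextual : ∀ {n} → Vec (Fin k) (suc n) → ℕ → ℕ → St
  contextual w X zero      = base (leftContext w X) (letter w X) (rightContext w X)
  contextual w X (suc len) = join (contextual w X len) (contextual w (suc X) len)

  tableCode : Code
  tableCode = contextCode ⟶ contextCode ⟶ code

  _at_,_ : ⟦ tableCode ⟧ → Context → Context → St
  t at l , r = fromCode (lookupTable contextCode code (lookupTable contextCode (contextCode ⟶ code) t l) r)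

  table : (Context → Context → St) → ⟦ tableCode ⟧
  table f = tabulateTable contextCode (contextCode ⟶ code)
              (λ l → tabulateTable contextCode code (λ r → toCode (f l r)))

  table-at : ∀ f l r → table f at l , r ≡ f l r
  table-at f l r
    rewrite lookupTable∘tabulateTable contextCode (contextCode ⟶ code)
              (λ l → tabulateTable contextCode code (λ r → toCode (f l r))) l
          | lookupTable∘tabulateTable contextCode code (λ r → toCode (f l r)) r
    = fromCode-toCode (f l r)

  summaryCode : Code
  summaryCode = fin k ⊗ fin k ⊗ tableCode

  Summary : Set
  Summary = ⟦ summaryCode ⟧

  letterSummary : Fin k → Summary
  letterSummary a = a , a , table (λ l r → base l a r)

  joinSummaries : Summary → Summary → Summary
  joinSummaries (first , _ , t₁) (_ , last , t₂) =
    first , last , table (λ l r → join (t₁ at l , push (true , last) r) (t₂ at push (true , first) l , r))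

  State : Set
  State = Fin k ⊎ Fin (size summaryCode)

  summary : State → Summary
  summary (inj₁ a) = letterSummary a
  summary (inj₂ i) = decode summaryCode i

  automaton : Trellis k
  automaton = record
    { m      = size summaryCode
    ; δ      = λ q₁ q₂ → inj₂ (encode summaryCode (joinSummaries (summary q₁) (summary q₂)))
    ; accept = λ q → acceptSummary (summary q)
    }
    where
    acceptSummary : Summary → Bool
    acceptSummary (first , last , t) = accept (t at outside first , outside last)

  summary-δ : ∀ q₁ q₂ → summary (Trellis.δ automaton q₁ q₂) ≡ joinSummaries (summary q₁) (summary q₂)
  summary-δ q₁ q₂ = decode-encode summaryCode _

  module _ {n : ℕ} (w : Vec (Fin k) (suc n)) where

    summaryOf : ℕ → ℕ → Summary
    summaryOf X len = summary (trellisState automaton (subword w X len))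

    summaryOf-suc : ∀ X len → summaryOf X (suc len) ≡ joinSummaries (summaryOf X len) (summaryOf (suc X) len)
    summaryOf-suc X len =
      trans (summary-δ (trellisState automaton (init (subword w X (suc len))))
                       (trellisState automaton (tail (subword w X (suc len)))))
            (cong₂ (λ u v → joinSummaries (summary (trellisState automaton u)) (summary (trellisState automaton v)))
                   (init-subword w X len) (tail-subword w X len))

    Summarises : ℕ → ℕ → Summary → Set
    Summarises X len (first , last , t) =
      first ≡ letter w X × last ≡ letter w (X + len) ×
      t at leftContext w X , rightContext w (X + len) ≡ contextual w X len

    joinSummaries-sound : ∀ X len s₁ s₂ → suc (X + len) ≤ n →
      Summarises X len s₁ → Summarises (suc X) len s₂ → Summarises X (suc len) (joinSummaries s₁ s₂)
    joinSummaries-sound X len (_ , _ , t₁) (_ , last₂ , t₂) Y<n (refl , _ , e₁) (_ , refl , e₂) =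
      refl , cong (letter w) (sym (+-suc X len)) ,
      trans (table-at (λ l r → join (t₁ at l , push (true , last₂) r) (t₂ at push (true , letter w X) l , r))
                      (leftContext w X) (rightContext w (X + suc len)))
            (cong₂ join (trans (cong (t₁ at leftContext w X ,_) pushRight) e₁)
                        (trans (cong₂ (t₂ at_,_) (push-leftContext w X) (cong (rightContext w) (+-suc X len))) e₂))
      where
      pushRight : push (true , letter w (suc X + len)) (rightContext w (X + suc len)) ≡ rightContext w (X + len)
      pushRight = trans (cong (λ j → push (true , letter w (suc X + len)) (rightContext w j)) (+-suc X len))
                        (push-rightContext w (X + len) Y<n)

    summary-subword : ∀ len X → X + len ≤ n → Summarises X len (summaryOf X len)
    summary-subword zero X _ =
      cong (letter w) (+-identityʳ X) , refl ,
      trans (table-at (λ l r → base l (letter w (X + 0)) r) (leftContext w X) (rightContext w (X + 0)))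
            (cong₂ (λ i j → base (leftContext w X) (letter w i) (rightContext w j)) (+-identityʳ X) (+-identityʳ X))
    summary-subword (suc len) X Y≤n =
      subst (Summarises X (suc len)) (sym (summaryOf-suc X len))
        (joinSummaries-sound X len (summaryOf X len) (summaryOf (suc X) len) Y<n
          (summary-subword len X (≤-trans (+-monoʳ-≤ X (n≤1+n len)) Y≤n))
          (summary-subword len (suc X) Y<n))
      where
      Y<n : suc (X + len) ≤ n
      Y<n = subst (_≤ n) (+-suc X len) Y≤n

    accept-automaton : Trellis.accept automaton (trellisState automaton w) ≡ accept (contextual w 0 n)
    accept-automaton
      with summary (trellisState automaton w)
         | subst (λ v → Summarises 0 n (summary (trellisState automaton v)))
                 (subword-whole w) (summary-subword n 0 ≤-refl)
    ... | first , last , t | refl , refl , e =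
      cong accept (trans (cong (t at outside (letter w 0) ,_) (sym (rightContext-end w))) e)

offset : ∀ {k r} → Literal k r → ℕ
offset (pos _ _ a) = ∣ a ∣
offset (neg _ _ a) = ∣ a ∣
offset eqxy        = 0
offset ltxy        = 0
offset (rel _ a b) = a + b

offsetBound : ∀ {k r} → List (Clause k r) → ℕ
offsetBound cls = sum (map (λ cl → sum (map offset (Clause.body cl))) cls)

_≟ᵇ_ : ∀ {k} → Fin k → Fin k → Bool
a ≟ᵇ b = ⌊ a ≟F b ⌋

∈⇒≤sum : ∀ {m ms} → m ∈ ms → m ≤ sum ms
∈⇒≤sum {ms = m ∷ ms}  (here refl)  = m≤m+n m (sum ms)
∈⇒≤sum {ms = m′ ∷ ms} (there m∈ms) = ≤-trans (∈⇒≤sum m∈ms) (m≤n+m (sum ms) m′)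

offset≤offsetBound : ∀ {k r} {cls : List (Clause k r)} {cl} → cl ∈ cls →
  All (λ l → offset l ≤ offsetBound cls) (Clause.body cl)
offset≤offsetBound cl∈cls = All.tabulate λ l∈body →
  ≤-trans (∈⇒≤sum (∈-map⁺ offset l∈body))
          (∈⇒≤sum (∈-map⁺ (λ cl → sum (map offset (Clause.body cl))) cl∈cls))

any-true⁺ : ∀ {A : Set} (p : A → Bool) {xs x} → x ∈ xs → p x ≡ true → any p xs ≡ true
any-true⁺ p x∈xs px = Equivalence.to T-≡ (any⁺ p (lose x∈xs (Equivalence.from T-≡ px)))

any-true⁻ : ∀ {A : Set} (p : A → Bool) xs → any p xs ≡ true → Σ A λ x → x ∈ xs × p x ≡ true
any-true⁻ p xs h with find (any⁻ p xs (Equivalence.from T-≡ h))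
... | x , x∈xs , px = x , x∈xs , Equivalence.to T-≡ px

headIs : ∀ {r} → Fin r → Head r → Bool
headIs S (relH S′) = S ≟ᵇ S′
headIs S botH      = false

headIs-sound : ∀ {r} {S : Fin r} h → headIs S h ≡ true → h ≡ relH S
headIs-sound {S = S} (relH S′) eq with S ≟F S′
... | yes refl = refl
headIs-sound botH ()

headIs-relH : ∀ {r} (S : Fin r) → headIs S (relH S) ≡ true
headIs-relH S with S ≟F S
... | yes _  = refl
... | no S≢S = ⊥-elim (S≢S refl)

isBot : ∀ {r} → Head r → Bool
isBot (relH _) = false
isBot botH     = true

isBot-sound : ∀ {r} (h : Head r) → isBot h ≡ true → h ≡ botH
isBot-sound botH _ = refl

isZero : ℕ → Bool
isZero zero    = true
isZero (suc _) = false

-- The automaton of a formula keeps, for the subword from x to y, everything the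
-- clauses can inspect: the letters within distance c of x and of y, and for all
-- a, b ≤ c whether x + a ≤ y - b and which relations the least model puts on
-- (x + a , y - b).  The least model at (x , y) itself is then the least fixpoint
-- of the clauses with head R(x , y), the other pairs being read off the children.
module HornAutomaton (k : ℕ) (Φ : InclHorn k) where

  open InclHorn Φ

  c : ℕ
  c = offsetBound clauses

  open BoundedContext k c

  Grid : Set → Set
  Grid A = Vec (Vec A (suc c)) (suc c)

  _[_,_] : ∀ {A : Set} → Grid A → ℕ → ℕ → A
  t [ a , b ] = lookup (lookup t (clamp c a)) (clamp c b)

  grid : ∀ {A : Set} → (ℕ → ℕ → A) → Grid A
  grid f = tabulate (λ a → tabulate (λ b → f (toℕ a) (toℕ b)))

  grid-[] : ∀ {A : Set} (f : ℕ → ℕ → A) {a b} → a ≤ c → b ≤ c → grid f [ a , b ] ≡ f a b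
  grid-[] f {a} {b} a≤c b≤c =
    trans (cong (λ row → lookup row (clamp c b)) (lookup∘tabulate (λ i → row (toℕ i)) (clamp c a)))
          (trans (lookup∘tabulate (λ j → f (toℕ (clamp c a)) (toℕ j)) (clamp c b))
                 (cong₂ f (toℕ-clamp-≤ a≤c) (toℕ-clamp-≤ b≤c)))
    where
    row : ℕ → Vec _ (suc c)
    row i = tabulate (λ j → f i (toℕ j))

  none : Vec Bool r
  none = replicate r false

  View : Set
  View = Context × Fin k × Context

  record Info : Set where
    field
      xView       : View
      yView       : View
      diagonal    : Bool
      ordered     : Grid Bool
      relations   : Grid (Vec Bool r)
      fails       : Bool
      failsWithin : Bool

  infoCoded : Coded Info
  infoCoded = record
    { code = viewCode ⊗ viewCode ⊗ bool ⊗ vec (suc c) (vec (suc c) bool)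
             ⊗ vec (suc c) (vec (suc c) (vec r bool)) ⊗ bool ⊗ bool
    ; toCode = λ i → let open Info i in
        xView , yView , diagonal , ordered , relations , fails , failsWithin
    ; fromCode = λ (xv , yv , d , o , rs , f , fw) → record
        { xView = xv ; yView = yv ; diagonal = d ; ordered = o ; relations = rs ; fails = f ; failsWithin = fw }
    ; fromCode-toCode = λ _ → refl
    }
    where
    viewCode : Code
    viewCode = contextCode ⊗ fin k ⊗ contextCode

  inside : Cell → Bool
  inside = proj₁

  cellAt : Context → ℕ → Cell
  cellAt ctx i = lookup ctx (clamp c i)

  letterAt : View → ℕ → Fin k
  letterAt (_ , a , _)  zero    = a
  letterAt (_ , _ , rc) (suc p) = proj₂ (cellAt rc p)

  atFirst atLast : View → Bool
  atFirst (lc , _ , _) = not (inside (cellAt lc 0))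
  atLast  (_ , _ , rc) = not (inside (cellAt rc 0))

  -- U(v + o) from the view of v.  As shifts saturate, v + o with o > 0 is the
  -- first position (and v - o the last) only in a one-letter word.
  evalAtom : View → Atom k → ℤ → Bool
  evalAtom v              (Q s) (+ p)       = letterAt v p ≟ᵇ s
  evalAtom v              minA  (+ zero)    = atFirst v
  evalAtom v              minA  (+ suc _)   = atFirst v ∧ atLast v
  evalAtom (_ , _ , rc)   maxA  (+ p)       = not (inside (cellAt rc p))
  evalAtom (lc , _ , _)   (Q s) -[1+ q ]    = proj₂ (cellAt lc q) ≟ᵇ s
  evalAtom (lc , _ , _)   minA  -[1+ q ]    = not (inside (cellAt lc (suc q)))
  evalAtom v              maxA  -[1+ _ ]    = atFirst v ∧ atLast v

  record Frame : Set where
    field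
      xView        : View
      yView        : View
      diagonal     : Bool
      ordered      : ℕ → ℕ → Bool
      inner        : ℕ → ℕ → Vec Bool r
      failsInside  : Bool

  module Local (e : Frame) where
    open Frame e

    isSelf : ℕ → ℕ → Bool
    isSelf a b = diagonal ∨ (isZero a ∧ isZero b)

    selfOrInner : Vec Bool r → ℕ → ℕ → Vec Bool r
    selfOrInner current a b = if isSelf a b then current else inner a b

    relationsAt : Vec Bool r → ℕ → ℕ → Vec Bool r
    relationsAt current a b = if ordered a b then selfOrInner current a b else none

    selfOrInner-self : ∀ current {a b} → isSelf a b ≡ true → selfOrInner current a b ≡ current
    selfOrInner-self current eq rewrite eq = refl

    selfOrInner-inner : ∀ current {a b} → isSelf a b ≡ false → selfOrInner current a b ≡ inner a b
    selfOrInner-inner current eq rewrite eq = refl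

    relationsAt-ordered : ∀ current {a b} → ordered a b ≡ true → relationsAt current a b ≡ selfOrInner current a b
    relationsAt-ordered current eq rewrite eq = refl

    relationsAt-unordered : ∀ current {a b} → ordered a b ≡ false → relationsAt current a b ≡ none
    relationsAt-unordered current eq rewrite eq = refl

    view : Var → View
    view vx = xView
    view vy = yView

    evalLit : Vec Bool r → Literal k r → Bool
    evalLit current (pos U v o) = evalAtom (view v) U o
    evalLit current (neg U v o) = not (evalAtom (view v) U o)
    evalLit current eqxy        = diagonal
    evalLit current ltxy        = not diagonal
    evalLit current (rel S a b) = ordered a b ∧ lookup (relationsAt current a b) S

    evalBody : Vec Bool r → List (Literal k r) → Bool
    evalBody current []       = true
    evalBody current (l ∷ ls) = evalLit current l ∧ evalBody current ls

    anyClause : (Clause k r → Bool) → Bool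
    anyClause f = any f clauses

    derive : Vec Bool r → Vec Bool r
    derive current = tabulate (λ S → anyClause (λ cl → headIs S (Clause.head cl) ∧ evalBody current (Clause.body cl)))

    open Inflation derive public

    least : Vec Bool r
    least = inflate (suc r)

    fires : Bool
    fires = anyClause (λ cl → isBot (Clause.head cl) ∧ evalBody least (Clause.body cl))

    info : Info
    info = record
      { xView = xView ; yView = yView ; diagonal = diagonal
      ; ordered = grid ordered
      ; relations = grid (relationsAt least)
      ; fails = fires
      ; failsWithin = failsInside ∨ fires }

  -- A single position: x + a ≤ x - b holds iff the shifts a and b are absorbed
  -- by the ends of the word.
  baseFrame : Context → Fin k → Context → Frame
  baseFrame lc a rc = record
    { xView = v ; yView = v ; diagonal = true
    ; ordered = λ a′ b′ → (isZero a′ ∨ atLast v) ∧ (isZero b′ ∨ atFirst v)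
    ; inner = λ _ _ → none ; failsInside = false }
    where v = lc , a , rc

  -- (x + a′ , y - b′) is read off the right child (x + 1 , y) when a′ > 0 and
  -- off the left child (x , y - 1) when a′ = 0 < b′.
  joinFrame : Info → Info → Frame
  joinFrame i₁ i₂ = record
    { xView = Info.xView i₁ ; yView = Info.yView i₂ ; diagonal = false
    ; ordered = fromChildren Info.ordered true
    ; inner = fromChildren Info.relations none
    ; failsInside = Info.failsWithin i₁ ∨ Info.failsWithin i₂ }
    where
    fromChildren : ∀ {A : Set} → (Info → Grid A) → A → ℕ → ℕ → A
    fromChildren g self (suc a) b       = g i₂ [ a , b ]
    fromChildren g self zero    (suc b) = g i₁ [ 0 , b ]
    fromChildren g self zero    zero    = self

  baseInfo : Context → Fin k → Context → Info
  baseInfo lc a rc = Local.info (baseFrame lc a rc)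

  joinInfo : Info → Info → Info
  joinInfo i₁ i₂ = Local.info (joinFrame i₁ i₂)

  open ContextTrellis infoCoded baseInfo joinInfo (not ∘ Info.failsWithin) public

X+0⊓n≡X : ∀ {n X} → X ≤ n → (X + 0) ⊓ n ≡ X
X+0⊓n≡X {n} {X} X≤n = trans (cong (_⊓ n) (+-identityʳ X)) (m≤n⇒m⊓n≡m X≤n)

X+1≰n⇒n≤X : ∀ {n} X → ¬ (X + 1 ≤ n) → n ≤ X
X+1≰n⇒n≤X {n} X h = ≮⇒≥ (λ X<n → h (subst (_≤ n) (+-comm 1 X) X<n))

X+1≰n⇒X+a⊓n≡n : ∀ {n} X a → ¬ (X + 1 ≤ n) → (X + a) ⊓ n ≡ n
X+1≰n⇒X+a⊓n≡n X a h = m≥n⇒m⊓n≡n (≤-trans (X+1≰n⇒n≤X X h) (m≤m+n X a))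

ordered-single : ∀ n X a b → X ≤ n →
  ((isZero a ∨ not (X + 1 ≤ᵇ n)) ∧ (isZero b ∨ not (1 ≤ᵇ X))) ≡ ((X + a) ⊓ n ≤ᵇ X ∸ b)
ordered-single n X zero zero X≤n = sym (≤ᵇ-true (≤-reflexive (X+0⊓n≡X X≤n)))
ordered-single n zero zero (suc b) X≤n = sym (≤ᵇ-true (≤-reflexive (X+0⊓n≡X X≤n)))
ordered-single n (suc X) zero (suc b) X≤n rewrite X+0⊓n≡X X≤n = sym (≤ᵇ-false (<⇒≱ (s≤s (m∸n≤m X b))))
ordered-single n X (suc a) b X≤n with X + 1 ≤? n
... | yes X<n rewrite ≤ᵇ-true X<n =
  sym (≤ᵇ-false (λ h → <⇒≱ (subst (suc (X ∸ b) ≤_) (+-comm 1 X) (s≤s (m∸n≤m X b)))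
                           (≤-trans (⊓-glb (+-monoʳ-≤ X (s≤s z≤n)) X<n) h)))
ordered-single n X (suc a) zero X≤n | no X≮n
  rewrite ≤ᵇ-false X≮n | X+1≰n⇒X+a⊓n≡n X (suc a) X≮n = sym (≤ᵇ-true (X+1≰n⇒n≤X X X≮n))
ordered-single n zero (suc a) (suc b) X≤n | no X≮n
  rewrite ≤ᵇ-false X≮n | X+1≰n⇒X+a⊓n≡n 0 (suc a) X≮n = sym (≤ᵇ-true (X+1≰n⇒n≤X 0 X≮n))
ordered-single n (suc X) (suc a) (suc b) X≤n | no X≮n
  rewrite ≤ᵇ-false X≮n | X+1≰n⇒X+a⊓n≡n (suc X) (suc a) X≮n =
  sym (≤ᵇ-false (λ h → <⇒≱ (s≤s (m∸n≤m X b)) (≤-trans X≤n h)))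


self-position : ∀ {n} X len a b → X + len ≤ n → (isZero len ∨ (isZero a ∧ isZero b)) ≡ true →
  (X + a) ⊓ n ≤ X + len ∸ b → ((X + a) ⊓ n ≡ X) × (X + len ∸ b ≡ X + len)
self-position {n} X zero a b Y≤n _ h =
  ≤-antisym (≤-trans h (≤-trans (m∸n≤m (X + 0) b) (≤-reflexive (+-identityʳ X)))) X≤X+a⊓n ,
  ≤-antisym (m∸n≤m (X + 0) b) (≤-trans (≤-reflexive (+-identityʳ X)) (≤-trans X≤X+a⊓n h))
  where
  X≤X+a⊓n : X ≤ (X + a) ⊓ n
  X≤X+a⊓n = ⊓-glb (m≤m+n X a) (subst (_≤ n) (+-identityʳ X) Y≤n)
self-position X (suc l) zero zero Y≤n _ _ = X+0⊓n≡X (m+n≤o⇒m≤o X Y≤n) , refl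

inner-shorter : ∀ {n} X len a b → X + len ≤ n → (isZero len ∨ (isZero a ∧ isZero b)) ≡ false →
  X + len ∸ b ∸ (X + a) ⊓ n < len
inner-shorter {n} X (suc l) (suc a) b Y≤n _ = s≤s (begin
  X + suc l ∸ b ∸ (X + suc a) ⊓ n ≤⟨ ∸-mono (m∸n≤m (X + suc l) b) (⊓-glb (+-monoʳ-≤ X (s≤s (z≤n {a}))) X+1≤n) ⟩
  X + suc l ∸ (X + 1)             ≡⟨ [m+n]∸[m+o]≡n∸o X (suc l) 1 ⟩
  l                               ∎)
  where
  open ≤-Reasoning
  X+1≤n : X + 1 ≤ n
  X+1≤n = ≤-trans (+-monoʳ-≤ X (s≤s z≤n)) Y≤n
inner-shorter {n} X (suc l) zero (suc b) Y≤n _ = s≤s (begin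
  X + suc l ∸ suc b ∸ (X + 0) ⊓ n ≤⟨ ∸-monoˡ-≤ ((X + 0) ⊓ n) (∸-monoʳ-≤ (X + suc l) (s≤s (z≤n {b}))) ⟩
  X + suc l ∸ 1 ∸ (X + 0) ⊓ n     ≡⟨ cong₂ _∸_ (cong (_∸ 1) (+-suc X l)) (X+0⊓n≡X (m+n≤o⇒m≤o X Y≤n)) ⟩
  X + l ∸ X                       ≡⟨ m+n∸m≡n X l ⟩
  l                               ∎)
  where open ≤-Reasoning

X+0⊓n≡0⇔ : ∀ {n} X → X ≤ n → (not (1 ≤ᵇ X) ≡ true) ⇔ ((X + 0) ⊓ n ≡ 0)
X+0⊓n≡0⇔ zero    X≤n = mk⇔ (λ _ → refl) (λ _ → refl)
X+0⊓n≡0⇔ (suc X) X≤n = mk⇔ (λ ()) (λ h → ⊥-elim (1+n≢0 (trans (sym (X+0⊓n≡X X≤n)) h)))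

X+1+p⊓n≡0⇔ : ∀ {n} X p → X ≤ n → ((not (1 ≤ᵇ X) ∧ not (X + 1 ≤ᵇ n)) ≡ true) ⇔ ((X + suc p) ⊓ n ≡ 0)
X+1+p⊓n≡0⇔ {n}     (suc X) p X≤n =
  mk⇔ (λ ()) (λ h → ⊥-elim (1+n≢0 (n≤0⇒n≡0 (subst (1 ≤_) h (⊓-glb (s≤s z≤n) (≤-trans (s≤s z≤n) X≤n))))))
X+1+p⊓n≡0⇔ {zero}  zero    p X≤n = mk⇔ (λ _ → refl) (λ _ → refl)
X+1+p⊓n≡0⇔ {suc n} zero    p X≤n = mk⇔ (λ ()) (λ ())

X+p⊓n≡n⇔ : ∀ {n} X p → (not (X + suc p ≤ᵇ n) ≡ true) ⇔ ((X + p) ⊓ n ≡ n)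
X+p⊓n≡n⇔ {n} X p with X + suc p ≤? n
... | yes X+p<n rewrite ≤ᵇ-true X+p<n =
  mk⇔ (λ ()) (λ h → ⊥-elim (<⇒≢ X+p<n′ (trans (sym (m≤n⇒m⊓n≡m (<⇒≤ X+p<n′))) h)))
  where
  X+p<n′ : X + p < n
  X+p<n′ = subst (_≤ n) (+-suc X p) X+p<n
... | no X+p≮n rewrite ≤ᵇ-false X+p≮n =
  mk⇔ (λ _ → m≥n⇒m⊓n≡n (≤-pred (subst (n <_) (+-suc X p) (≰⇒> X+p≮n)))) (λ _ → refl)

X∸1+q≡0⇔ : ∀ X q → (not (suc (suc q) ≤ᵇ X) ≡ true) ⇔ (X ∸ suc q ≡ 0)
X∸1+q≡0⇔ X q with suc (suc q) ≤? X
... | yes q+1<X rewrite ≤ᵇ-true q+1<X =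
  mk⇔ (λ ()) (λ h → ⊥-elim (1+n≢0 (n≤0⇒n≡0 (subst (1 ≤_) h (m+n≤o⇒m≤o∸n 1 q+1<X)))))
... | no q+1≮X  rewrite ≤ᵇ-false q+1≮X = mk⇔ (λ _ → m≤n⇒m∸n≡0 (≤-pred (≰⇒> q+1≮X))) (λ _ → refl)

X∸1+q≡n⇔ : ∀ {n} X q → X ≤ n → ((not (1 ≤ᵇ X) ∧ not (X + 1 ≤ᵇ n)) ≡ true) ⇔ (X ∸ suc q ≡ n)
X∸1+q≡n⇔ {n}     (suc X) q X≤n = mk⇔ (λ ()) (λ h → ⊥-elim (<⇒≢ (≤-trans (s≤s (m∸n≤m X q)) X≤n) h))
X∸1+q≡n⇔ {zero}  zero    q X≤n = mk⇔ (λ _ → refl) (λ _ → refl)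
X∸1+q≡n⇔ {suc n} zero    q X≤n = mk⇔ (λ ()) (λ ())

≟ᵇ-correct : ∀ {k} (a b : Fin k) → ((a ≟ᵇ b) ≡ true) ⇔ (a ≡ b)
≟ᵇ-correct a b with a ≟F b
... | yes a≡b = mk⇔ (λ _ → a≡b) (λ _ → refl)
... | no a≢b  = mk⇔ (λ ()) (λ a≡b → ⊥-elim (a≢b a≡b))

not-correct : ∀ {b : Bool} {A : Set} → (b ≡ true) ⇔ A → (not b ≡ true) ⇔ (¬ A)
not-correct {true}  b⇔A = mk⇔ (λ ()) (λ ¬a → ⊥-elim (¬a (Equivalence.to b⇔A refl)))
not-correct {false} b⇔A = mk⇔ (λ _ a → false≢true (Equivalence.from b⇔A a)) (λ _ → refl)

isZero-∸⇔ : ∀ {X Y} → X ≤ Y → (isZero (Y ∸ X) ≡ true) ⇔ (X ≡ Y)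
isZero-∸⇔ {X} {Y} X≤Y with Y ∸ X in eq
... | zero  = mk⇔ (λ _ → ≤-antisym X≤Y (m∸n≡0⇒m≤n eq)) (λ _ → refl)
... | suc _ = mk⇔ (λ ()) (λ X≡Y → ⊥-elim (1+n≢0 (trans (sym eq) (trans (cong (Y ∸_) X≡Y) (n∸n≡0 Y)))))

≡⇒⇔ : ∀ {A B : Set} → A ≡ B → A ⇔ B
≡⇒⇔ refl = ⇔.refl

≤ᵇ-∧⇔ : ∀ {i j β} → ((i ≤ᵇ j) ∧ β ≡ true) ⇔ ((β ≡ true) × i ≤ j)
≤ᵇ-∧⇔ {i} {j} {β} = mk⇔ (λ h → ∧-conicalʳ (i ≤ᵇ j) β h , ≤ᵇ-sound (∧-conicalˡ (i ≤ᵇ j) β h))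
                        (λ (h , i≤j) → ∧-true (≤ᵇ-true i≤j) h)

module HornCorrect (k : ℕ) (Φ : InclHorn k) {n : ℕ} (w : Vec (Fin k) (suc n)) where

  open InclHorn Φ
  open HornAutomaton k Φ
  open BoundedContext k c

  infoAt : ℕ → ℕ → Info
  infoAt = contextual w

  frameAt : ℕ → ℕ → Frame
  frameAt X zero      = baseFrame (leftContext w X) (letter w X) (rightContext w X)
  frameAt X (suc len) = joinFrame (infoAt X len) (infoAt (suc X) len)

  infoAt-frameAt : ∀ X len → infoAt X len ≡ Local.info (frameAt X len)
  infoAt-frameAt X zero      = refl
  infoAt-frameAt X (suc len) = refl

  ordered-infoAt : ∀ X len {a b} → a ≤ c → b ≤ c → Info.ordered (infoAt X len) [ a , b ] ≡ Frame.ordered (frameAt X len) a b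
  ordered-infoAt X len a≤c b≤c rewrite infoAt-frameAt X len = grid-[] (Frame.ordered (frameAt X len)) a≤c b≤c

  relations-infoAt : ∀ X len {a b} → a ≤ c → b ≤ c →
    Info.relations (infoAt X len) [ a , b ] ≡ Local.relationsAt (frameAt X len) (Local.least (frameAt X len)) a b
  relations-infoAt X len a≤c b≤c rewrite infoAt-frameAt X len =
    grid-[] (Local.relationsAt (frameAt X len) (Local.least (frameAt X len))) a≤c b≤c

  cellAt-leftContext : ∀ X {i} → i ≤ c → cellAt (leftContext w X) i ≡ ((suc i ≤ᵇ X) , letter w (X ∸ suc i))
  cellAt-leftContext X i≤c = trans (lookup∘tabulate (leftCell w X) (clamp c _))
                                   (cong (λ j → (suc j ≤ᵇ X) , letter w (X ∸ suc j)) (toℕ-clamp-≤ i≤c))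

  cellAt-rightContext : ∀ Y {i} → i ≤ c → cellAt (rightContext w Y) i ≡ ((Y + suc i ≤ᵇ n) , letter w (Y + suc i))
  cellAt-rightContext Y i≤c = trans (lookup∘tabulate (rightCell w Y) (clamp c _))
                                    (cong (λ j → (Y + suc j ≤ᵇ n) , letter w (Y + suc j)) (toℕ-clamp-≤ i≤c))

  ordered-frameAt : ∀ len X {a b} → X + len ≤ n → a ≤ c → b ≤ c →
    Frame.ordered (frameAt X len) a b ≡ ((X + a) ⊓ n ≤ᵇ X + len ∸ b)
  ordered-frameAt zero X {a} {b} X≤n _ _
    rewrite cellAt-rightContext X {0} z≤n | cellAt-leftContext X {0} z≤n | +-identityʳ X
    = ordered-single n X a b X≤n
  ordered-frameAt (suc l) X {suc a} {b} Y≤n a≤c b≤c = begin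
    Info.ordered (infoAt (suc X) l) [ a , b ] ≡⟨ ordered-infoAt (suc X) l a≤c′ b≤c ⟩
    Frame.ordered (frameAt (suc X) l) a b    ≡⟨ ordered-frameAt l (suc X) (subst (_≤ n) (+-suc X l) Y≤n) a≤c′ b≤c ⟩
    ((suc X + a) ⊓ n ≤ᵇ suc X + l ∸ b)       ≡⟨ cong₂ (λ p q → p ⊓ n ≤ᵇ q ∸ b) (+-suc X a) (+-suc X l) ⟨
    ((X + suc a) ⊓ n ≤ᵇ X + suc l ∸ b)       ∎
    where
    open ≡-Reasoning
    a≤c′ : a ≤ c
    a≤c′ = ≤-trans (n≤1+n a) a≤c
  ordered-frameAt (suc l) X {zero} {suc b} Y≤n a≤c b≤c = begin
    Info.ordered (infoAt X l) [ 0 , b ]      ≡⟨ ordered-infoAt X l z≤n b≤c′ ⟩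
    Frame.ordered (frameAt X l) 0 b          ≡⟨ ordered-frameAt l X (≤-trans (+-monoʳ-≤ X (n≤1+n l)) Y≤n) z≤n b≤c′ ⟩
    ((X + 0) ⊓ n ≤ᵇ X + l ∸ b)               ≡⟨ cong (λ q → (X + 0) ⊓ n ≤ᵇ q ∸ suc b) (+-suc X l) ⟨
    ((X + 0) ⊓ n ≤ᵇ X + suc l ∸ suc b)       ∎
    where
    open ≡-Reasoning
    b≤c′ : b ≤ c
    b≤c′ = ≤-trans (n≤1+n b) b≤c
  ordered-frameAt (suc l) X {zero} {zero} Y≤n _ _ =
    sym (≤ᵇ-true (≤-trans (m⊓n≤m (X + 0) n) (+-monoʳ-≤ X z≤n)))

  leastAt : ℕ → ℕ → Vec Bool r
  leastAt i j = if i ≤ᵇ j then Local.least (frameAt i (j ∸ i)) else none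

  leastAt-≤ : ∀ i j → (i ≤ᵇ j) ≡ true → leastAt i j ≡ Local.least (frameAt i (j ∸ i))
  leastAt-≤ i j eq rewrite eq = refl

  leastAt-self : ∀ X len → leastAt X (X + len) ≡ Local.least (frameAt X len)
  leastAt-self X len = trans (leastAt-≤ X (X + len) (≤ᵇ-true (m≤m+n X len)))
                             (cong (λ l → Local.least (frameAt X l)) (m+n∸m≡n X len))

  relations-correct : ∀ len X {a b} → X + len ≤ n → a ≤ c → b ≤ c →
    Info.relations (infoAt X len) [ a , b ] ≡ leastAt ((X + a) ⊓ n) (X + len ∸ b)

  relations-ordered : ∀ len X {a b} → X + len ≤ n → a ≤ c → b ≤ c → (X + a) ⊓ n ≤ X + len ∸ b →
    Local.selfOrInner (frameAt X len) (Local.least (frameAt X len)) a b ≡ leastAt ((X + a) ⊓ n) (X + len ∸ b)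
  relations-ordered zero X {a} {b} Y≤n _ _ x+a≤y-b = sym (begin
    leastAt ((X + a) ⊓ n) (X + 0 ∸ b) ≡⟨ cong₂ leastAt (proj₁ absorbed) (proj₂ absorbed) ⟩
    leastAt X (X + 0)                 ≡⟨ leastAt-self X 0 ⟩
    Local.least (frameAt X 0)         ∎)
    where
    open ≡-Reasoning
    absorbed : ((X + a) ⊓ n ≡ X) × (X + 0 ∸ b ≡ X + 0)
    absorbed = self-position X 0 a b Y≤n refl x+a≤y-b
  relations-ordered (suc l) X {zero} {zero} Y≤n _ _ _ = sym (begin
    leastAt ((X + 0) ⊓ n) (X + suc l ∸ 0) ≡⟨ cong (λ i → leastAt i (X + suc l)) (X+0⊓n≡X (m+n≤o⇒m≤o X Y≤n)) ⟩
    leastAt X (X + suc l)                 ≡⟨ leastAt-self X (suc l) ⟩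
    Local.least (frameAt X (suc l))       ∎)
    where open ≡-Reasoning
  relations-ordered (suc l) X {suc a} {b} Y≤n a≤c b≤c _ = begin
    Info.relations (infoAt (suc X) l) [ a , b ]
      ≡⟨ relations-correct l (suc X) (subst (_≤ n) (+-suc X l) Y≤n) (≤-trans (n≤1+n a) a≤c) b≤c ⟩
    leastAt ((suc X + a) ⊓ n) (suc X + l ∸ b)   ≡⟨ cong₂ (λ p q → leastAt (p ⊓ n) (q ∸ b)) (+-suc X a) (+-suc X l) ⟨
    leastAt ((X + suc a) ⊓ n) (X + suc l ∸ b)   ∎
    where open ≡-Reasoning
  relations-ordered (suc l) X {zero} {suc b} Y≤n a≤c b≤c _ = begin
    Info.relations (infoAt X l) [ 0 , b ]
      ≡⟨ relations-correct l X (≤-trans (+-monoʳ-≤ X (n≤1+n l)) Y≤n) z≤n (≤-trans (n≤1+n b) b≤c) ⟩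
    leastAt ((X + 0) ⊓ n) (X + l ∸ b)           ≡⟨ cong (λ q → leastAt ((X + 0) ⊓ n) (q ∸ suc b)) (+-suc X l) ⟨
    leastAt ((X + 0) ⊓ n) (X + suc l ∸ suc b)   ∎
    where open ≡-Reasoning

  relations-correct len X {a} {b} Y≤n a≤c b≤c with (X + a) ⊓ n ≤ᵇ X + len ∸ b in eq
  ... | true = begin
    Info.relations (infoAt X len) [ a , b ]                        ≡⟨ relations-infoAt X len a≤c b≤c ⟩
    Local.relationsAt (frameAt X len) least a b                    ≡⟨ Local.relationsAt-ordered (frameAt X len) least ordered≡ ⟩
    Local.selfOrInner (frameAt X len) least a b                    ≡⟨ relations-ordered len X Y≤n a≤c b≤c (≤ᵇ-sound eq) ⟩
    leastAt ((X + a) ⊓ n) (X + len ∸ b)                            ≡⟨ leastAt-≤ ((X + a) ⊓ n) (X + len ∸ b) eq ⟩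
    Local.least (frameAt ((X + a) ⊓ n) (X + len ∸ b ∸ (X + a) ⊓ n)) ∎
    where
    open ≡-Reasoning
    least : Vec Bool r
    least = Local.least (frameAt X len)
    ordered≡ : Frame.ordered (frameAt X len) a b ≡ true
    ordered≡ = trans (ordered-frameAt len X Y≤n a≤c b≤c) eq
  ... | false = trans (relations-infoAt X len a≤c b≤c)
                      (Local.relationsAt-unordered (frameAt X len) _ (trans (ordered-frameAt len X Y≤n a≤c b≤c) eq))

  AtomAt : Atom k → ℕ → Set
  AtomAt (Q s) P = letter w P ≡ s
  AtomAt minA  P = P ≡ 0
  AtomAt maxA  P = P ≡ n

  atomHolds⇔AtomAt : ∀ {R : Interp r n} {x y} U (i : Fin (suc n)) → atomHolds w R x y U i ⇔ AtomAt U (toℕ i)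
  atomHolds⇔AtomAt (Q s) i rewrite clamp-toℕ i = mk⇔ (λ h → h) (λ h → h)
  atomHolds⇔AtomAt minA  i = mk⇔ (cong toℕ) toℕ-injective
  atomHolds⇔AtomAt maxA  i = mk⇔ (λ h → trans (cong toℕ h) (toℕ-fromℕ n))
                                 (λ h → toℕ-injective (trans h (sym (toℕ-fromℕ n))))

  viewAt : ℕ → View
  viewAt X = leftContext w X , letter w X , rightContext w X

  letterAt-viewAt : ∀ X {p} → p ≤ c → letterAt (viewAt X) p ≡ letter w ((X + p) ⊓ n)
  letterAt-viewAt X {zero}  _   = sym (trans (letter-⊓ w (X + 0)) (cong (letter w) (+-identityʳ X)))
  letterAt-viewAt X {suc p} p≤c = trans (cong proj₂ (cellAt-rightContext X (≤-trans (n≤1+n p) p≤c)))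
                                        (sym (letter-⊓ w (X + suc p)))

  evalAtom-correct : ∀ X U o → X ≤ n → ∣ o ∣ ≤ c → (evalAtom (viewAt X) U o ≡ true) ⇔ AtomAt U (shift n X o)
  evalAtom-correct X (Q s) (+ p) X≤n o≤c
    rewrite letterAt-viewAt X o≤c = ≟ᵇ-correct (letter w ((X + p) ⊓ n)) s
  evalAtom-correct X minA (+ zero) X≤n o≤c
    rewrite cellAt-leftContext X {0} z≤n = X+0⊓n≡0⇔ X X≤n
  evalAtom-correct X minA (+ suc p) X≤n o≤c
    rewrite cellAt-leftContext X {0} z≤n | cellAt-rightContext X {0} z≤n = X+1+p⊓n≡0⇔ X p X≤n
  evalAtom-correct X maxA (+ p) X≤n o≤c
    rewrite cellAt-rightContext X o≤c = X+p⊓n≡n⇔ X p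
  evalAtom-correct X (Q s) -[1+ q ] X≤n o≤c
    rewrite cellAt-leftContext X (≤-trans (n≤1+n q) o≤c) = ≟ᵇ-correct (letter w (X ∸ suc q)) s
  evalAtom-correct X minA -[1+ q ] X≤n o≤c
    rewrite cellAt-leftContext X o≤c = X∸1+q≡0⇔ X q
  evalAtom-correct X maxA -[1+ q ] X≤n o≤c
    rewrite cellAt-leftContext X {0} z≤n | cellAt-rightContext X {0} z≤n = X∸1+q≡n⇔ X q X≤n

  evalAtom-atomHolds : ∀ {R : Interp r n} {x y} (v : Fin (suc n)) U o → ∣ o ∣ ≤ c →
    (evalAtom (viewAt (toℕ v)) U o ≡ true) ⇔ atomHolds w R x y U (v ⊕ o)
  evalAtom-atomHolds {R} {x} {y} v U o o≤c =
    ⇔.trans (evalAtom-correct (toℕ v) U o (toℕ≤pred[n] v) o≤c)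
            (subst (λ P → AtomAt U P ⇔ atomHolds w R x y U (v ⊕ o)) (toℕ-⊕ v o)
                   (⇔.sym (atomHolds⇔AtomAt {R} {x} {y} U (v ⊕ o))))

  xView-frameAt : ∀ X len → Frame.xView (frameAt X len) ≡ viewAt X
  xView-frameAt X zero    = refl
  xView-frameAt X (suc l) = trans (cong Info.xView (infoAt-frameAt X l)) (xView-frameAt X l)

  yView-frameAt : ∀ X len → Frame.yView (frameAt X len) ≡ viewAt (X + len)
  yView-frameAt X zero    = cong viewAt (sym (+-identityʳ X))
  yView-frameAt X (suc l) = trans (cong Info.yView (infoAt-frameAt (suc X) l))
                                  (trans (yView-frameAt (suc X) l) (cong viewAt (sym (+-suc X l))))

  diagonal-frameAt : ∀ X len → Frame.diagonal (frameAt X len) ≡ isZero len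
  diagonal-frameAt X zero    = refl
  diagonal-frameAt X (suc l) = refl

  leastModel : Interp r n
  leastModel S u v = lookup (leastAt (toℕ u) (toℕ v)) S

  module AtPair (x y : Fin (suc n)) (x≤y : toℕ x ≤ toℕ y) where

    X len : ℕ
    X   = toℕ x
    len = toℕ y ∸ toℕ x

    X+len≡y : X + len ≡ toℕ y
    X+len≡y = m+[n∸m]≡n x≤y

    X+len≤n : X + len ≤ n
    X+len≤n = subst (_≤ n) (sym X+len≡y) (toℕ≤pred[n] y)

    frame : Frame
    frame = frameAt X len

    open Local frame

    evalAtom-view : ∀ {R : Interp r n} v U o → ∣ o ∣ ≤ c →
      (evalAtom (view v) U o ≡ true) ⇔ atomHolds w R x y U (varVal w R x y v ⊕ o)
    evalAtom-view {R} vx U o o≤c rewrite xView-frameAt X len = evalAtom-atomHolds {R} {x} {y} x U o o≤c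
    evalAtom-view {R} vy U o o≤c rewrite yView-frameAt X len | X+len≡y = evalAtom-atomHolds {R} {x} {y} y U o o≤c

    evalLit-diagonal : (Frame.diagonal frame ≡ true) ⇔ (x ≡ y)
    evalLit-diagonal rewrite diagonal-frameAt X len =
      ⇔.trans (isZero-∸⇔ x≤y) (mk⇔ toℕ-injective (cong toℕ))

    evalLit-plain : ∀ (R : Interp r n) current l → offset l ≤ c → (∀ {S a b} → l ≢ rel S a b) →
      (evalLit current l ≡ true) ⇔ litHolds w R x y l
    evalLit-plain R current (pos U v o) o≤c _ = evalAtom-view {R} v U o o≤c
    evalLit-plain R current (neg U v o) o≤c _ = not-correct (evalAtom-view {R} v U o o≤c)
    evalLit-plain R current eqxy        _   _ = evalLit-diagonal
    evalLit-plain R current ltxy        _   _ =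
      mk⇔ (λ h → ≤∧≢⇒< x≤y (λ X≡Y → Equivalence.to (not-correct evalLit-diagonal) h (toℕ-injective X≡Y)))
          (λ x<y → Equivalence.from (not-correct evalLit-diagonal) (λ x≡y → <⇒≢ x<y (cong toℕ x≡y)))
    evalLit-plain R current (rel S a b) _ not-rel = ⊥-elim (not-rel refl)

    x+a y-b : ℕ → ℕ
    x+a a = (X + a) ⊓ n
    y-b b = X + len ∸ b

    toℕ-x⊕a : ∀ a → toℕ (x ⊕ (+ a)) ≡ x+a a
    toℕ-x⊕a a = toℕ-⊕ x (+ a)

    toℕ-y⊖b : ∀ b → toℕ (y ⊖ b) ≡ y-b b
    toℕ-y⊖b b = trans (toℕ-⊖ y b) (cong (_∸ b) (sym X+len≡y))

    evalRel-least : ∀ S {a b} → a ≤ c → b ≤ c → (evalLit least (rel S a b) ≡ true) ⇔ litHolds w leastModel x y (rel S a b)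
    evalRel-least S {a} {b} a≤c b≤c =
      ⇔.trans (≡⇒⇔ (cong (_≡ true) evaluated)) (⇔.trans ≤ᵇ-∧⇔ (≡⇒⇔ positions))
      where
      evaluated : evalLit least (rel S a b) ≡ ((x+a a ≤ᵇ y-b b) ∧ lookup (leastAt (x+a a) (y-b b)) S)
      evaluated = cong₂ (λ o v → o ∧ lookup v S) (ordered-frameAt len X X+len≤n a≤c b≤c)
                        (trans (sym (relations-infoAt X len a≤c b≤c)) (relations-correct len X X+len≤n a≤c b≤c))
      positions : ((lookup (leastAt (x+a a) (y-b b)) S ≡ true) × x+a a ≤ y-b b) ≡ litHolds w leastModel x y (rel S a b)
      positions = cong₂ (λ p q → (lookup (leastAt p q) S ≡ true) × p ≤ q) (sym (toℕ-x⊕a a)) (sym (toℕ-y⊖b b))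

    Below : Interp r n → Set
    Below R′ = ∀ (u v : Fin (suc n)) → toℕ u ≤ toℕ v → toℕ v ∸ toℕ u < len →
               ∀ S → leastModel S u v ≡ true → R′ S u v ≡ true

    HoldsAt : Interp r n → Vec Bool r → Set
    HoldsAt R′ current = ∀ S → lookup current S ≡ true → R′ S x y ≡ true

    isSelf≡ : ∀ a b → isSelf a b ≡ (isZero len ∨ (isZero a ∧ isZero b))
    isSelf≡ a b = cong (_∨ (isZero a ∧ isZero b)) (diagonal-frameAt X len)

    self-sound : ∀ R′ current S {a b} → x+a a ≤ y-b b → isSelf a b ≡ true → HoldsAt R′ current →
      lookup (selfOrInner current a b) S ≡ true → R′ S (x ⊕ (+ a)) (y ⊖ b) ≡ true
    self-sound R′ current S {a} {b} ordered self holds h =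
      subst₂ (λ u v → R′ S u v ≡ true)
        (sym (toℕ-injective (trans (toℕ-x⊕a a) (proj₁ absorbed))))
        (sym (toℕ-injective (trans (toℕ-y⊖b b) (trans (proj₂ absorbed) X+len≡y))))
        (holds S (trans (cong (λ v → lookup v S) (sym (selfOrInner-self current self))) h))
      where
      absorbed : (x+a a ≡ X) × (y-b b ≡ X + len)
      absorbed = self-position X len a b X+len≤n (trans (sym (isSelf≡ a b)) self) ordered

    inner-sound : ∀ R′ current S {a b} → a ≤ c → b ≤ c → Frame.ordered frame a b ≡ true → isSelf a b ≡ false →
      Below R′ → lookup (selfOrInner current a b) S ≡ true → R′ S (x ⊕ (+ a)) (y ⊖ b) ≡ true
    inner-sound R′ current S {a} {b} a≤c b≤c orderedᵇ inner below h =
      below (x ⊕ (+ a)) (y ⊖ b) x⊕a≤y⊖b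
        (subst₂ (λ p q → q ∸ p < len) (sym (toℕ-x⊕a a)) (sym (toℕ-y⊖b b))
                (inner-shorter X len a b X+len≤n (trans (sym (isSelf≡ a b)) inner)))
        S (begin
          lookup (leastAt (toℕ (x ⊕ (+ a))) (toℕ (y ⊖ b))) S ≡⟨ cong₂ (λ p q → lookup (leastAt p q) S) (toℕ-x⊕a a) (toℕ-y⊖b b) ⟩
          lookup (leastAt (x+a a) (y-b b)) S                  ≡⟨ cong (λ v → lookup v S) leastAt≡inner ⟩
          lookup (Frame.inner frame a b) S                    ≡⟨ cong (λ v → lookup v S) (selfOrInner-inner current inner) ⟨
          lookup (selfOrInner current a b) S                  ≡⟨ h ⟩
          true                                                ∎)
      where
      open ≡-Reasoning
      x⊕a≤y⊖b : toℕ (x ⊕ (+ a)) ≤ toℕ (y ⊖ b)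
      x⊕a≤y⊖b = subst₂ _≤_ (sym (toℕ-x⊕a a)) (sym (toℕ-y⊖b b))
                       (≤ᵇ-sound (trans (sym (ordered-frameAt len X X+len≤n a≤c b≤c)) orderedᵇ))
      leastAt≡inner : leastAt (x+a a) (y-b b) ≡ Frame.inner frame a b
      leastAt≡inner = begin
        leastAt (x+a a) (y-b b)                 ≡⟨ relations-correct len X X+len≤n a≤c b≤c ⟨
        Info.relations (infoAt X len) [ a , b ] ≡⟨ relations-infoAt X len a≤c b≤c ⟩
        relationsAt least a b                   ≡⟨ relationsAt-ordered least orderedᵇ ⟩
        selfOrInner least a b                   ≡⟨ selfOrInner-inner least inner ⟩
        Frame.inner frame a b                   ∎

    evalRel-sound : ∀ R′ current S {a b} → a ≤ c → b ≤ c → HoldsAt R′ current → Below R′ →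
      evalLit current (rel S a b) ≡ true → litHolds w R′ x y (rel S a b)
    evalRel-sound R′ current S {a} {b} a≤c b≤c holds below h = bySelf (isSelf a b) refl , x⊕a≤y⊖b
      where
      orderedᵇ : Frame.ordered frame a b ≡ true
      orderedᵇ = ∧-conicalˡ _ _ h
      ordered : x+a a ≤ y-b b
      ordered = ≤ᵇ-sound (trans (sym (ordered-frameAt len X X+len≤n a≤c b≤c)) orderedᵇ)
      x⊕a≤y⊖b : toℕ (x ⊕ (+ a)) ≤ toℕ (y ⊖ b)
      x⊕a≤y⊖b = subst₂ _≤_ (sym (toℕ-x⊕a a)) (sym (toℕ-y⊖b b)) ordered
      inSelfOrInner : lookup (selfOrInner current a b) S ≡ true
      inSelfOrInner = trans (cong (λ v → lookup v S) (sym (relationsAt-ordered current orderedᵇ))) (∧-conicalʳ _ _ h)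
      bySelf : ∀ β → isSelf a b ≡ β → R′ S (x ⊕ (+ a)) (y ⊖ b) ≡ true
      bySelf true  self  = self-sound R′ current S ordered self holds inSelfOrInner
      bySelf false inner = inner-sound R′ current S a≤c b≤c orderedᵇ inner below inSelfOrInner

    evalLit-least : ∀ l → offset l ≤ c → (evalLit least l ≡ true) ⇔ litHolds w leastModel x y l
    evalLit-least (rel S a b) o≤c = evalRel-least S (m+n≤o⇒m≤o a o≤c) (m+n≤o⇒n≤o a o≤c)
    evalLit-least l@(pos _ _ _) o≤c = evalLit-plain leastModel least l o≤c (λ ())
    evalLit-least l@(neg _ _ _) o≤c = evalLit-plain leastModel least l o≤c (λ ())
    evalLit-least eqxy          o≤c = evalLit-plain leastModel least eqxy o≤c (λ ())
    evalLit-least ltxy          o≤c = evalLit-plain leastModel least ltxy o≤c (λ ())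

    evalLit-sound : ∀ R′ current l → offset l ≤ c → HoldsAt R′ current → Below R′ →
      evalLit current l ≡ true → litHolds w R′ x y l
    evalLit-sound R′ current (rel S a b) o≤c holds below =
      evalRel-sound R′ current S (m+n≤o⇒m≤o a o≤c) (m+n≤o⇒n≤o a o≤c) holds below
    evalLit-sound R′ current l@(pos _ _ _) o≤c _ _ = Equivalence.to (evalLit-plain R′ current l o≤c (λ ()))
    evalLit-sound R′ current l@(neg _ _ _) o≤c _ _ = Equivalence.to (evalLit-plain R′ current l o≤c (λ ()))
    evalLit-sound R′ current eqxy          o≤c _ _ = Equivalence.to (evalLit-plain R′ current eqxy o≤c (λ ()))
    evalLit-sound R′ current ltxy          o≤c _ _ = Equivalence.to (evalLit-plain R′ current ltxy o≤c (λ ()))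

    evalBody-least : ∀ ls → All (λ l → offset l ≤ c) ls → (evalBody least ls ≡ true) ⇔ All (litHolds w leastModel x y) ls
    evalBody-least []       []           = mk⇔ (λ _ → []) (λ _ → refl)
    evalBody-least (l ∷ ls) (o≤c ∷ os≤c) = mk⇔
      (λ h → Equivalence.to (evalLit-least l o≤c) (∧-conicalˡ _ _ h) ∷ Equivalence.to (evalBody-least ls os≤c) (∧-conicalʳ _ _ h))
      (λ { (p ∷ ps) → ∧-true (Equivalence.from (evalLit-least l o≤c) p) (Equivalence.from (evalBody-least ls os≤c) ps) })

    evalBody-sound : ∀ R′ current ls → All (λ l → offset l ≤ c) ls → HoldsAt R′ current → Below R′ →
      evalBody current ls ≡ true → All (litHolds w R′ x y) ls
    evalBody-sound R′ current []       []           _     _     _ = []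
    evalBody-sound R′ current (l ∷ ls) (o≤c ∷ os≤c) holds below h =
      evalLit-sound R′ current l o≤c holds below (∧-conicalˡ _ _ h) ∷
      evalBody-sound R′ current ls os≤c holds below (∧-conicalʳ _ _ h)

  leastModel-least : ∀ x y (x≤y : toℕ x ≤ toℕ y) S → leastModel S x y ≡ lookup (Local.least (AtPair.frame x y x≤y)) S
  leastModel-least x y x≤y S = cong (λ v → lookup v S) (leastAt-≤ (toℕ x) (toℕ y) (≤ᵇ-true x≤y))

  module _ (R′ : Interp r n) (model : ∀ x y → All (clauseHolds w R′ x y) clauses) where

    least⊆model : ∀ x y (x≤y : toℕ x ≤ toℕ y) → AtPair.Below x y x≤y R′ →
      ∀ S → lookup (Local.least (AtPair.frame x y x≤y)) S ≡ true → R′ S x y ≡ true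
    least⊆model x y x≤y below = inflate-least (λ S → R′ S x y ≡ true) derive-preserves (suc r)
      where
      open AtPair x y x≤y
      open Local frame
      derive-preserves : ∀ v → HoldsAt R′ v → ∀ S → lookup (derive v) S ≡ true → R′ S x y ≡ true
      derive-preserves v holds S h
        with any-true⁻ (λ cl → headIs S (Clause.head cl) ∧ evalBody v (Clause.body cl)) clauses
                       (trans (sym (lookup∘tabulate _ S)) h)
      ... | cl , cl∈ , fired =
        subst (headHolds w R′ x y) (headIs-sound (Clause.head cl) (∧-conicalˡ _ _ fired))
          (All.lookup (model x y) cl∈ x≤y
            (evalBody-sound R′ v (Clause.body cl) (offset≤offsetBound cl∈) holds below (∧-conicalʳ _ _ fired)))

    leastModel⊆model : ∀ N (u v : Fin (suc n)) → toℕ u ≤ toℕ v → toℕ v ∸ toℕ u < N →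
      ∀ S → leastModel S u v ≡ true → R′ S u v ≡ true
    leastModel⊆model (suc N) u v u≤v v-u<N S h =
      least⊆model u v u≤v (λ u′ v′ u′≤v′ shorter → leastModel⊆model N u′ v′ u′≤v′ (≤-trans shorter (≤-pred v-u<N)))
        S (trans (sym (leastModel-least u v u≤v S)) h)

    litHolds-leastModel : ∀ x y l → litHolds w leastModel x y l → litHolds w R′ x y l
    litHolds-leastModel x y (pos U v o) h = h
    litHolds-leastModel x y (neg U v o) h = h
    litHolds-leastModel x y eqxy        h = h
    litHolds-leastModel x y ltxy        h = h
    litHolds-leastModel x y (rel S a b) (h , ordered) =
      leastModel⊆model _ (x ⊕ (+ a)) (y ⊖ b) ordered ≤-refl S h , ordered

  fails-infoAt : ∀ X len → Info.fails (infoAt X len) ≡ Local.fires (frameAt X len)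
  fails-infoAt X len = cong Info.fails (infoAt-frameAt X len)

  failsWithin-complete : ∀ len X X′ len′ → X ≤ X′ → X′ + len′ ≤ X + len →
    Info.fails (infoAt X′ len′) ≡ true → Info.failsWithin (infoAt X len) ≡ true
  failsWithin-complete zero X X′ len′ X≤X′ Y′≤Y fails′ =
    subst₂ (λ X″ len″ → Info.failsWithin (infoAt X″ len″) ≡ true) X′≡X len′≡0 (failsWithin-self X′ len′ fails′)
    where
    Y′≤X : X′ + len′ ≤ X
    Y′≤X = subst (X′ + len′ ≤_) (+-identityʳ X) Y′≤Y
    X′≡X : X′ ≡ X
    X′≡X = ≤-antisym (≤-trans (m≤m+n X′ len′) Y′≤X) X≤X′
    len′≡0 : len′ ≡ 0
    len′≡0 = n≤0⇒n≡0 (+-cancelˡ-≤ X′ len′ 0 (≤-trans Y′≤X (≤-trans X≤X′ (≤-reflexive (sym (+-identityʳ X′))))))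
    failsWithin-self : ∀ X len → Info.fails (infoAt X len) ≡ true → Info.failsWithin (infoAt X len) ≡ true
    failsWithin-self X len fails rewrite infoAt-frameAt X len = ∨-trueʳ (Frame.failsInside (frameAt X len)) fails
  failsWithin-complete (suc l) X X′ len′ X≤X′ Y′≤Y fails′ with X′ + len′ ≤? X + l | suc X ≤? X′
  ... | yes Y′≤Y-1 | _ = ∨-trueˡ _ (∨-trueˡ _ (failsWithin-complete l X X′ len′ X≤X′ Y′≤Y-1 fails′))
  ... | no _ | yes X<X′ =
    ∨-trueˡ _ (∨-trueʳ (Info.failsWithin (infoAt X l))
      (failsWithin-complete l (suc X) X′ len′ X<X′ (subst (X′ + len′ ≤_) (+-suc X l) Y′≤Y) fails′))
  ... | no Y′≰Y-1 | no X′≮X =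
    ∨-trueʳ (Info.failsWithin (infoAt X l) ∨ Info.failsWithin (infoAt (suc X) l))
      (subst₂ (λ X″ len″ → Info.fails (infoAt X″ len″) ≡ true) X′≡X len′≡1+l fails′)
    where
    X′≡X : X′ ≡ X
    X′≡X = ≤-antisym (≤-pred (≰⇒> X′≮X)) X≤X′
    len′≡1+l : len′ ≡ suc l
    len′≡1+l = +-cancelˡ-≡ X len′ (suc l) (trans (cong (_+ len′) (sym X′≡X))
                 (≤-antisym Y′≤Y (subst (_≤ X′ + len′) (sym (+-suc X l)) (≰⇒> Y′≰Y-1))))

  failsWithin-sound : ∀ len X → Info.failsWithin (infoAt X len) ≡ true →
    Σ ℕ λ X′ → Σ ℕ λ len′ → X ≤ X′ × X′ + len′ ≤ X + len × Info.fails (infoAt X′ len′) ≡ true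
  failsWithin-sound zero X h = X , 0 , ≤-refl , ≤-refl , h
  failsWithin-sound (suc l) X h with ∨-true-split (Info.failsWithin (infoAt X l) ∨ Info.failsWithin (infoAt (suc X) l)) h
  ... | inj₂ fails = X , suc l , ≤-refl , ≤-refl , fails
  ... | inj₁ inside with ∨-true-split (Info.failsWithin (infoAt X l)) inside
  ...   | inj₁ left with failsWithin-sound l X left
  ...     | X′ , l′ , X≤X′ , Y′≤Y , fails = X′ , l′ , X≤X′ , ≤-trans Y′≤Y (+-monoʳ-≤ X (n≤1+n l)) , fails
  failsWithin-sound (suc l) X h | inj₁ inside | inj₂ right with failsWithin-sound l (suc X) right
  ... | X′ , l′ , X<X′ , Y′≤Y , fails =
    X′ , l′ , ≤-trans (n≤1+n X) X<X′ , subst (X′ + l′ ≤_) (sym (+-suc X l)) Y′≤Y , fails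

  leastModel-model : Info.failsWithin (infoAt 0 n) ≡ false → ∀ x y → All (clauseHolds w leastModel x y) clauses
  leastModel-model noFailure x y = All.tabulate clause-holds
    where
    clause-holds : ∀ {cl} → cl ∈ clauses → clauseHolds w leastModel x y cl
    clause-holds {cl} cl∈ x≤y holds = byHead (Clause.head cl) refl
      where
      open AtPair x y x≤y
      open Local frame
      body-least : evalBody least (Clause.body cl) ≡ true
      body-least = Equivalence.from (evalBody-least (Clause.body cl) (offset≤offsetBound cl∈)) holds
      byHead : ∀ h → Clause.head cl ≡ h → headHolds w leastModel x y h
      byHead (relH S) head≡ = trans (leastModel-least x y x≤y S) (inflate-closed S (trans (lookup∘tabulate _ S)
        (any-true⁺ (λ cl → headIs S (Clause.head cl) ∧ evalBody least (Clause.body cl)) cl∈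
          (∧-true (trans (cong (headIs S) head≡) (headIs-relH S)) body-least))))
      byHead botH head≡ = false≢true (trans (sym noFailure)
        (failsWithin-complete n 0 X len z≤n X+len≤n (trans (fails-infoAt X len)
          (any-true⁺ (λ cl → isBot (Clause.head cl) ∧ evalBody least (Clause.body cl)) cl∈
            (∧-true (cong isBot head≡) body-least)))))

  fires-refutes : ∀ X len → X + len ≤ n → Local.fires (frameAt X len) ≡ true → ¬ Models Φ n w
  fires-refutes X len Y≤n fired (R′ , model) = refute
    (any-true⁻ (λ cl → isBot (Clause.head cl) ∧ Local.evalBody frame (Local.least frame) (Clause.body cl)) clauses
               (subst (λ f → Local.fires f ≡ true) frame≡ fired))
    where
    x′ y′ : Fin (suc n)
    x′ = clamp n X
    y′ = clamp n (X + len)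
    toℕ-x′ : toℕ x′ ≡ X
    toℕ-x′ = toℕ-clamp-≤ (m+n≤o⇒m≤o X Y≤n)
    toℕ-y′ : toℕ y′ ≡ X + len
    toℕ-y′ = toℕ-clamp-≤ Y≤n
    x′≤y′ : toℕ x′ ≤ toℕ y′
    x′≤y′ = subst₂ _≤_ (sym toℕ-x′) (sym toℕ-y′) (m≤m+n X len)
    frame : Frame
    frame = AtPair.frame x′ y′ x′≤y′
    frame≡ : frameAt X len ≡ frame
    frame≡ = cong₂ frameAt (sym toℕ-x′) (sym (trans (cong₂ _∸_ toℕ-y′ toℕ-x′) (m+n∸m≡n X len)))
    refute : (Σ (Clause k r) λ cl → cl ∈ clauses ×
               (isBot (Clause.head cl) ∧ Local.evalBody frame (Local.least frame) (Clause.body cl)) ≡ true) → ⊥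
    refute (cl , cl∈ , bot∧body) = subst (headHolds w R′ x′ y′) (isBot-sound (Clause.head cl) (∧-conicalˡ _ _ bot∧body))
      (All.lookup (model x′ y′) cl∈ x′≤y′
        (All.map (λ {l} → litHolds-leastModel R′ model x′ y′ l)
          (Equivalence.to (AtPair.evalBody-least x′ y′ x′≤y′ (Clause.body cl) (offset≤offsetBound cl∈))
            (∧-conicalʳ _ _ bot∧body))))

  model⇒noFailure : Models Φ n w → Info.failsWithin (infoAt 0 n) ≡ false
  model⇒noFailure model with Info.failsWithin (infoAt 0 n) in eq
  ... | false = refl
  ... | true with failsWithin-sound n 0 eq
  ...   | X , len , _ , Y≤n , fails = ⊥-elim (fires-refutes X len Y≤n (trans (sym (fails-infoAt X len)) fails) model)

lemma10 : (k : ℕ) (Φ : InclHorn k) → InTrellis (Models Φ)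
lemma10 k Φ = automaton , λ n w → let open HornCorrect k Φ w in
    (λ model → trans (accept-automaton w) (cong not (model⇒noFailure model)))
  , (λ accepted → leastModel , leastModel-model
      (trans (sym (not-involutive _)) (cong not (trans (sym (accept-automaton w)) accepted))))
  where open HornAutomaton k Φ
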